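{- Let $n\geq 13$, let $S_n$ be the symmetric group of degree $n$ with identity $e$, let $S=\{c_n=(1\ 2\ \cdots\ n),c_n^{ -1},(1\ 2)\}$, and let $\Gamma_n=\mathrm{Cay}(S_n,S)$. Then $\mathrm{Aut}(\Gamma_n)_e=\mathrm{Aut}(S_n,S)$; equivalently, $\Gamma_n$ is a normal Cayley graph.
   Context: For a finite group $G$ and a subset $S\subseteq G$ with $e\notin S$ and $S=S^{ -1}$, the Cayley graph $\mathrm{Cay}(G,S)$ is the undirected graph with vertex set $G$ in which $g,h$ are adjacent iff $hg^{ -1}\in S$. $\mathrm{Aut}(\mathrm{Cay}(G,S))$ is its full automorphism group and $\mathrm{Aut}(\mathrm{Cay}(G,S))_e$ the stabilizer of the vertex $e$. $\mathrm{Aut}(G,S)=\{\sigma\in\mathrm{Aut}(G): S^\sigma=S\}$. The right regular representation is $R(G)=\{r_g: x\mapsto xg\mid g\in G\}\le \mathrm{Aut}(\mathrm{Cay}(G,S))$. The Cayley graph is called normal if $R(G)$ is a normal subgroup of $\mathrm{Aut}(\mathrm{Cay}(G,S))$. -}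

module Defs where

open import Data.Nat using (ℕ; zero; suc)
open import Data.Fin using (Fin; zero; suc; fromℕ; inject₁)
open import Data.Fin.Permutation as P
  using (Permutation′; permutation; _∘ₚ_; flip; transpose; _⟨$⟩ʳ_)
open import Data.Product using (Σ; _×_; ∃-syntax)
open import Data.Sum using (_⊎_)
open import Function.Bundles using (_⇔_)
open import Relation.Binary.PropositionalEquality using (_≡_; refl; cong; sym; trans)

-- The symmetric group S_n on the points Fin n = {0,…,n-1}
-- (point k here corresponds to the point k+1 of the paper).
-- Elements are stdlib permutations, compared pointwise.

Perm : ℕ → Set
Perm n = Permutation′ n

infix 4 _≈_
_≈_ : ∀ {n} → Perm n → Perm n → Set
π ≈ ρ = π P.≈ ρ

e : ∀ {n} → Perm n
e = P.id

-- group product: x ↦ x^(g·h) = (x^g)^h  (apply g first, then h)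
infixl 7 _·_
_·_ : ∀ {n} → Perm n → Perm n → Perm n
g · h = g ∘ₚ h

infix 8 _⁻¹
_⁻¹ : ∀ {n} → Perm n → Perm n
g ⁻¹ = flip g

-- The n-cycle c_n = (1 2 ⋯ n), i.e. k ↦ k+1 (mod n) on Fin n.

rot : ∀ {m} → Fin (suc m) → Fin (suc m)
rot {zero}  zero    = zero
rot {suc m} zero    = suc zero
rot {suc m} (suc i) = lift (rot i)
  where
  lift : Fin (suc m) → Fin (suc (suc m))
  lift zero    = zero
  lift (suc j) = suc (suc j)

unrot : ∀ {m} → Fin (suc m) → Fin (suc m)
unrot {zero}  zero    = zero
unrot {suc m} zero    = fromℕ (suc m)
unrot {suc m} (suc j) = inject₁ j

rot-last : ∀ m → rot (fromℕ m) ≡ zero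
rot-last zero    = refl
rot-last (suc m) rewrite rot-last m = refl

rot-inject : ∀ {m} (j : Fin (suc m)) → rot (inject₁ j) ≡ suc j
rot-inject {zero}  zero    = refl
rot-inject {suc m} zero    = refl
rot-inject {suc m} (suc j) rewrite rot-inject j = refl

rot-unrot : ∀ {m} (i : Fin (suc m)) → rot (unrot i) ≡ i
rot-unrot {zero}  zero    = refl
rot-unrot {suc m} zero    = rot-last (suc m)
rot-unrot {suc m} (suc j) = rot-inject j

unrot-zero : ∀ m → fromℕ m ≡ unrot {m} zero
unrot-zero zero    = refl
unrot-zero (suc m) = refl

unrot-suc : ∀ {m} (k : Fin m) → unrot {m} (suc k) ≡ inject₁ k
unrot-suc {suc m} k = refl

unrot-rot : ∀ {m} (i : Fin (suc m)) → unrot (rot i) ≡ i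
unrot-rot {zero}  zero    = refl
unrot-rot {suc m} zero    = refl
unrot-rot {suc m} (suc i) with rot i | unrot-rot i
... | zero  | eq = cong suc (trans (unrot-zero m) eq)
... | suc k | eq = cong suc (trans (sym (unrot-suc k)) eq)

cycleₙ : ∀ n → Perm n
cycleₙ zero    = P.id
cycleₙ (suc m) = permutation rot unrot (λ i → rot-unrot i) (λ i → unrot-rot i)

-- The transposition (1 2), i.e. swapping the points 0 and 1 of Fin n
-- (degenerate case n < 2 set to the identity; irrelevant for n ≥ 13).
trans₁₂ : ∀ n → Perm n
trans₁₂ (suc (suc m)) = transpose zero (suc zero)
trans₁₂ _             = P.id

InS : ∀ n → Perm n → Set
InS n x = (x ≈ cycleₙ n) ⊎ (x ≈ cycleₙ n ⁻¹) ⊎ (x ≈ trans₁₂ n)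

Adj : ∀ n → Perm n → Perm n → Set
Adj n g h = InS n (h · g ⁻¹)

Congruent : ∀ {n} → (Perm n → Perm n) → Set
Congruent f = ∀ {x y} → x ≈ y → f x ≈ f y

IsBijection : ∀ {n} → (Perm n → Perm n) → Set
IsBijection {n} f =
  Congruent f ×
  (∀ x y → f x ≈ f y → x ≈ y) ×
  (∀ (y : Perm n) → ∃[ x ] (f x ≈ y))

IsGraphAut : ∀ n → (Perm n → Perm n) → Set
IsGraphAut n f = IsBijection f × (∀ g h → Adj n g h ⇔ Adj n (f g) (f h))

InAutΓₑ : ∀ n → (Perm n → Perm n) → Set
InAutΓₑ n f = IsGraphAut n f × (f e ≈ e)

IsGroupAut : ∀ n → (Perm n → Perm n) → Set
IsGroupAut n f = IsBijection f × (∀ x y → f (x · y) ≈ f x · f y)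

MapsSOntoS : ∀ n → (Perm n → Perm n) → Set
MapsSOntoS n f =
  (∀ s → InS n s → InS n (f s)) ×
  (∀ s → InS n s → ∃[ t ] (InS n t × (f t ≈ s)))

InAutGS : ∀ n → (Perm n → Perm n) → Set
InAutGS n f = IsGroupAut n f × MapsSOntoS n f

module Submission where

-- Label each edge g — s·g by its letter s.  An automorphism σ of Γₙ maps
-- the edges at g to those at σ g, giving σ(s·g) = (label g s)·σ(g), and so
-- transports walks (words) to walks, preserving closedness, reducedness
-- and length.  For n ≥ 13 every closed reduced word of length 12 is one of
-- ten listed words (a finite symbolic check); four begin with t and three
-- with each of c, c⁻¹, so counting them forces label g t = t.  The listed
-- words beginning t x t y have y = x⁻¹, which shows that label g c does
-- not change along edges; as the letters generate Sₙ it is constant, so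
-- σ(w·g) = φ(w)·σ(g) for one involution φ of the letters: σ ∈ Aut(Sₙ,S).

open import Defs
open import Data.Nat using (ℕ; _≤_)
open import Function.Bundles using (_⇔_)

open import Data.Nat as ℕ using (zero; suc; z≤n; s≤s; _∸_; _+_)
import Data.Nat.Properties as ℕP
open import Data.Fin using (Fin; zero; suc; toℕ; fromℕ; inject₁)
open import Data.Fin.Patterns using (0F; 1F; 2F; 3F)
import Data.Fin.Properties as FinP
open import Data.Fin.Permutation as P using (_⟨$⟩ʳ_; _⟨$⟩ˡ_; inverseˡ; inverseʳ)
import Data.Fin.Permutation.Components as PC
open import Data.Fin.Permutation.Transposition.List as TL using (TranspositionList)
open import Data.Bool using (Bool; true; false; _∧_; _∨_; T)
open import Data.Bool.Properties using (T-∧; T-∨)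
open import Data.List using (List; []; _∷_; length; _++_; map; head)
open import Data.List.Properties using (∷-injectiveˡ; ∷-injectiveʳ; ≡-dec)
open import Data.List.Relation.Unary.Linked using (Linked; []; [-]; _∷_; linked?)
open import Data.Maybe as Maybe using (Maybe; just; nothing)
open import Data.Product using (Σ; _×_; _,_; proj₁; proj₂; ∃)
open import Data.Sum using (inj₁; inj₂)
open import Data.Empty using (⊥; ⊥-elim)
open import Function.Bundles using (Equivalence; mk⇔)
open import Relation.Nullary using (¬_; Dec; yes; no; does)
open import Relation.Nullary.Decidable using (dec-true; dec-false; isYes; toWitness; from-yes; ¬?)
open import Relation.Binary using (DecidableEquality; tri<; tri≈; tri>)
open import Relation.Binary.PropositionalEquality

module PermutationLaws {n : ℕ} where

  ·-cong : {a a′ b b′ : Perm n} → a ≈ a′ → b ≈ b′ → a · b ≈ a′ · b′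
  ·-cong {b = b} p q x = trans (cong (b ⟨$⟩ʳ_) (p x)) (q _)

  ⟨$⟩ʳ-injective : (π : Perm n) {x y : Fin n} → π ⟨$⟩ʳ x ≡ π ⟨$⟩ʳ y → x ≡ y
  ⟨$⟩ʳ-injective π p = trans (sym (inverseˡ π)) (trans (cong (π ⟨$⟩ˡ_) p) (inverseˡ π))

  ·-cancelʳ : {a b : Perm n} (g : Perm n) → a · g ≈ b · g → a ≈ b
  ·-cancelʳ g p x = ⟨$⟩ʳ-injective g (p x)

  ·-inverseʳ : (g : Perm n) → g · g ⁻¹ ≈ e
  ·-inverseʳ g x = inverseˡ g

  ·⁻¹⇒· : {a b : Perm n} (g : Perm n) → a · g ⁻¹ ≈ b → a ≈ b · g
  ·⁻¹⇒· g p x = trans (sym (inverseʳ g)) (cong (g ⟨$⟩ʳ_) (p x))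

  ·⇒·⁻¹ : {a b : Perm n} (g : Perm n) → a ≈ b · g → a · g ⁻¹ ≈ b
  ·⇒·⁻¹ g p x = trans (cong (g ⟨$⟩ˡ_) (p x)) (inverseˡ g)

open PermutationLaws

-- Case distinctions are
-- made on Dec arguments of local helpers, since τ itself branches on the
-- very same equality tests.
module Transpositions {n : ℕ} where

  τ : Fin n → Fin n → Fin n → Fin n
  τ = PC.transpose

  τ-left : (a b : Fin n) → τ a b a ≡ b
  τ-left a b rewrite dec-true (a FinP.≟ a) refl = refl

  τ-fix : (a b x : Fin n) → x ≢ a → x ≢ b → τ a b x ≡ x
  τ-fix a b x x≢a x≢b rewrite dec-false (x FinP.≟ a) x≢a | dec-false (x FinP.≟ b) x≢b = refl

  τ-right : (a b : Fin n) → τ a b b ≡ a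
  τ-right a b = by-cases (b FinP.≟ a)
    where
    by-cases : Dec (b ≡ a) → τ a b b ≡ a
    by-cases (yes refl) = τ-left b b
    by-cases (no b≢a) rewrite dec-false (b FinP.≟ a) b≢a | dec-true (b FinP.≟ b) refl = refl

  τ-sym : (a b x : Fin n) → τ a b x ≡ τ b a x
  τ-sym a b x = by-cases (x FinP.≟ a) (x FinP.≟ b)
    where
    by-cases : Dec (x ≡ a) → Dec (x ≡ b) → τ a b x ≡ τ b a x
    by-cases (yes refl) (yes refl) = refl
    by-cases (yes refl) (no _)     = trans (τ-left a b) (sym (τ-right b a))
    by-cases (no _)     (yes refl) = trans (τ-right a b) (sym (τ-left b a))
    by-cases (no x≢a)   (no x≢b)   = trans (τ-fix a b x x≢a x≢b) (sym (τ-fix b a x x≢b x≢a))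

  τ-self : (a x : Fin n) → τ a a x ≡ x
  τ-self a x = by-cases (x FinP.≟ a)
    where
    by-cases : Dec (x ≡ a) → τ a a x ≡ x
    by-cases (yes refl) = τ-left x x
    by-cases (no x≢a)   = τ-fix a a x x≢a x≢a

  τ-involutive : (a b x : Fin n) → τ a b (τ a b x) ≡ x
  τ-involutive a b x = trans (cong (τ a b) (τ-sym a b x)) (PC.transpose-inverse a b)

  τ-conjugate : (f g : Fin n → Fin n) → (∀ y → f (g y) ≡ y) → (∀ x → g (f x) ≡ x) →
                (a b y : Fin n) → f (τ a b (g y)) ≡ τ (f a) (f b) y
  τ-conjugate f g fg gf a b y = by-cases (y FinP.≟ f a) (y FinP.≟ f b)
    where
    open ≡-Reasoning

    avoid : ∀ {z} → y ≢ f z → g y ≢ z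
    avoid y≢fz gy≡z = y≢fz (trans (sym (fg y)) (cong f gy≡z))

    by-cases : Dec (y ≡ f a) → Dec (y ≡ f b) → f (τ a b (g y)) ≡ τ (f a) (f b) y
    by-cases (yes refl) _ = begin
      f (τ a b (g (f a))) ≡⟨ cong (λ z → f (τ a b z)) (gf a) ⟩
      f (τ a b a)         ≡⟨ cong f (τ-left a b) ⟩
      f b                 ≡⟨ sym (τ-left (f a) (f b)) ⟩
      τ (f a) (f b) (f a) ∎
    by-cases (no _) (yes refl) = begin
      f (τ a b (g (f b))) ≡⟨ cong (λ z → f (τ a b z)) (gf b) ⟩
      f (τ a b b)         ≡⟨ cong f (τ-right a b) ⟩
      f a                 ≡⟨ sym (τ-right (f a) (f b)) ⟩
      τ (f a) (f b) (f b) ∎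
    by-cases (no y≢fa) (no y≢fb) = begin
      f (τ a b (g y)) ≡⟨ cong f (τ-fix a b (g y) (avoid y≢fa) (avoid y≢fb)) ⟩
      f (g y)         ≡⟨ fg y ⟩
      y               ≡⟨ sym (τ-fix (f a) (f b) y y≢fa y≢fb) ⟩
      τ (f a) (f b) y ∎

  τ-conjugate-τ : (a b u v y : Fin n) → τ a b (τ u v (τ a b y)) ≡ τ (τ a b u) (τ a b v) y
  τ-conjugate-τ a b = τ-conjugate (τ a b) (τ a b) (τ-involutive a b) (τ-involutive a b)

  disjoint-square : (a b d₁ d₂ : Fin n) → a ≢ d₁ → a ≢ d₂ → b ≢ d₁ → b ≢ d₂ →
                    (P.transpose d₁ d₂ · P.transpose a b) · (P.transpose d₁ d₂ · P.transpose a b) ≈ e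
  disjoint-square a b d₁ d₂ a≢d₁ a≢d₂ b≢d₁ b≢d₂ x = begin
    τ a b (τ d₁ d₂ (τ a b (τ d₁ d₂ x)))
      ≡⟨ cong (τ a b) (τ-conjugate-τ d₁ d₂ a b x) ⟩
    τ a b (τ (τ d₁ d₂ a) (τ d₁ d₂ b) x)
      ≡⟨ cong₂ (λ u v → τ a b (τ u v x)) (τ-fix d₁ d₂ a a≢d₁ a≢d₂) (τ-fix d₁ d₂ b b≢d₁ b≢d₂) ⟩
    τ a b (τ a b x)
      ≡⟨ τ-involutive a b x ⟩
    x ∎
    where open ≡-Reasoning

  overlapping-cube : (a b d : Fin n) → a ≢ b → b ≢ d → a ≢ d →
                     let ρ = P.transpose b d · P.transpose a b in ρ · ρ · ρ ≈ e
  overlapping-cube a b d a≢b b≢d a≢d x = begin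
    τ a b (τ b d (τ a b (τ b d (τ a b (τ b d x)))))
      ≡⟨ τ-conjugate-τ a b b d y ⟩
    τ (τ a b b) (τ a b d) (τ b d (τ a b (τ b d x)))
      ≡⟨ cong₂ (λ u v → τ u v y) (τ-right a b) (τ-fix a b d (≢-sym a≢d) (≢-sym b≢d)) ⟩
    τ a d (τ b d (τ a b (τ b d x)))
      ≡⟨ cong (τ a d) (τ-conjugate-τ b d a b x) ⟩
    τ a d (τ (τ b d a) (τ b d b) x)
      ≡⟨ cong₂ (λ u v → τ a d (τ u v x)) (τ-fix b d a a≢b a≢d) (τ-left b d) ⟩
    τ a d (τ a d x)
      ≡⟨ τ-involutive a d x ⟩
    x ∎
    where
    open ≡-Reasoning
    y : Fin n
    y = τ b d (τ a b (τ b d x))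

data Letter : Set where
  c c⁻ t : Letter

inv : Letter → Letter
inv c  = c⁻
inv c⁻ = c
inv t  = t

inv-involutive : ∀ a → inv (inv a) ≡ a
inv-involutive c  = refl
inv-involutive c⁻ = refl
inv-involutive t  = refl

inv-injective : ∀ {a b} → inv a ≡ inv b → a ≡ b
inv-injective {a} {b} p = trans (sym (inv-involutive a)) (trans (cong inv p) (inv-involutive b))

other-rotation : ∀ {x y} → x ≢ t → y ≢ t → x ≢ y → y ≡ inv x
other-rotation {c}  {c⁻} _ _ _ = refl
other-rotation {c⁻} {c}  _ _ _ = refl
other-rotation {t}  x≢t _   _  = ⊥-elim (x≢t refl)
other-rotation {_}  {t} _   y≢t _ = ⊥-elim (y≢t refl)
other-rotation {c}  {c}  _ _ x≢y = ⊥-elim (x≢y refl)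
other-rotation {c⁻} {c⁻} _ _ x≢y = ⊥-elim (x≢y refl)

_≟ₗ_ : DecidableEquality Letter
c  ≟ₗ c  = yes refl
c⁻ ≟ₗ c⁻ = yes refl
t  ≟ₗ t  = yes refl
c  ≟ₗ c⁻ = no λ ()
c  ≟ₗ t  = no λ ()
c⁻ ≟ₗ c  = no λ ()
c⁻ ≟ₗ t  = no λ ()
t  ≟ₗ c  = no λ ()
t  ≟ₗ c⁻ = no λ ()

-- A word is read as a walk: its first letter is the first step.
Word : Set
Word = List Letter

Reduced : Word → Set
Reduced = Linked (λ a b → b ≢ inv a)

reduced? : (w : Word) → Dec (Reduced w)
reduced? = linked? λ a b → ¬? (b ≟ₗ inv a)

relabel : Letter → Letter → Letter
relabel x c  = x
relabel x c⁻ = inv x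
relabel x t  = t

relabel-involutive : ∀ x → x ≢ t → ∀ a → relabel x (relabel x a) ≡ a
relabel-involutive c  _   c  = refl
relabel-involutive c  _   c⁻ = refl
relabel-involutive c⁻ _   c  = refl
relabel-involutive c⁻ _   c⁻ = refl
relabel-involutive _  _   t  = refl
relabel-involutive t  x≢t _  = ⊥-elim (x≢t refl)

allLetters : (Letter → Bool) → Bool
allLetters p = p c ∧ p c⁻ ∧ p t

allLetters-sound : ∀ p → T (allLetters p) → ∀ y → T (p y)
allLetters-sound p h c  = proj₁ (Equivalence.to T-∧ h)
allLetters-sound p h c⁻ = proj₁ (Equivalence.to T-∧ (proj₂ (Equivalence.to (T-∧ {p c}) h)))
allLetters-sound p h t  = proj₂ (Equivalence.to T-∧ (proj₂ (Equivalence.to (T-∧ {p c}) h)))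

allReducedFrom : ℕ → Letter → (Word → Bool) → Bool
allReducedFrom zero    x p = p (x ∷ [])
allReducedFrom (suc k) x p =
  allLetters λ y → does (y ≟ₗ inv x) ∨ allReducedFrom k y (λ v → p (x ∷ v))

allReducedFrom-sound : ∀ k x p → T (allReducedFrom k x p) →
                       ∀ v → length v ≡ k → Reduced (x ∷ v) → T (p (x ∷ v))
allReducedFrom-sound zero x p h [] refl _ = h
allReducedFrom-sound (suc k) x p h (y ∷ v) len (y≢x⁻ ∷ red)
  with y ≟ₗ inv x
     | allLetters-sound (λ z → does (z ≟ₗ inv x) ∨ allReducedFrom k z (λ w → p (x ∷ w))) h y
... | yes y≡x⁻ | _    = ⊥-elim (y≢x⁻ y≡x⁻)
... | no _     | rest =
  allReducedFrom-sound k y (λ w → p (x ∷ w)) rest v (ℕP.suc-injective len) red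

-- The closed reduced words of length 12 (for n ≥ 13), grouped by their
-- first letter: count x of them start with x.  Only the inclusion "every
-- closed reduced 12-word is listed" is proved and needed.
count : Letter → ℕ
count c  = 3
count c⁻ = 3
count t  = 4

closedWord : (x : Letter) → Fin (count x) → Word
closedWord c zero             = c ∷ c ∷ t ∷ c⁻ ∷ c⁻ ∷ t ∷ c ∷ c ∷ t ∷ c⁻ ∷ c⁻ ∷ t ∷ []
closedWord c (suc zero)       = c ∷ t ∷ c⁻ ∷ c⁻ ∷ t ∷ c ∷ c ∷ t ∷ c⁻ ∷ c⁻ ∷ t ∷ c ∷ []
closedWord c (suc (suc zero)) = c ∷ t ∷ c⁻ ∷ t ∷ c ∷ t ∷ c⁻ ∷ t ∷ c ∷ t ∷ c⁻ ∷ t ∷ []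
closedWord c⁻ zero             = c⁻ ∷ c⁻ ∷ t ∷ c ∷ c ∷ t ∷ c⁻ ∷ c⁻ ∷ t ∷ c ∷ c ∷ t ∷ []
closedWord c⁻ (suc zero)       = c⁻ ∷ t ∷ c ∷ c ∷ t ∷ c⁻ ∷ c⁻ ∷ t ∷ c ∷ c ∷ t ∷ c⁻ ∷ []
closedWord c⁻ (suc (suc zero)) = c⁻ ∷ t ∷ c ∷ t ∷ c⁻ ∷ t ∷ c ∷ t ∷ c⁻ ∷ t ∷ c ∷ t ∷ []
closedWord t zero                   = t ∷ c ∷ t ∷ c⁻ ∷ t ∷ c ∷ t ∷ c⁻ ∷ t ∷ c ∷ t ∷ c⁻ ∷ []
closedWord t (suc zero)             = t ∷ c⁻ ∷ t ∷ c ∷ t ∷ c⁻ ∷ t ∷ c ∷ t ∷ c⁻ ∷ t ∷ c ∷ []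
closedWord t (suc (suc zero))       = t ∷ c ∷ c ∷ t ∷ c⁻ ∷ c⁻ ∷ t ∷ c ∷ c ∷ t ∷ c⁻ ∷ c⁻ ∷ []
closedWord t (suc (suc (suc zero))) = t ∷ c⁻ ∷ c⁻ ∷ t ∷ c ∷ c ∷ t ∷ c⁻ ∷ c⁻ ∷ t ∷ c ∷ c ∷ []

four-words : ∀ x → 4 ℕ.≤ count x → x ≡ t
four-words t  _ = refl
four-words c  (s≤s (s≤s (s≤s ())))
four-words c⁻ (s≤s (s≤s (s≤s ())))

tWord-length : ∀ i → length (closedWord t i) ≡ 12
tWord-length zero                   = refl
tWord-length (suc zero)             = refl
tWord-length (suc (suc zero))       = refl
tWord-length (suc (suc (suc zero))) = refl

tWord-reduced : ∀ i → Reduced (closedWord t i)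
tWord-reduced zero                   = from-yes (reduced? (closedWord t zero))
tWord-reduced (suc zero)             = from-yes (reduced? (closedWord t (suc zero)))
tWord-reduced (suc (suc zero))       = from-yes (reduced? (closedWord t (suc (suc zero))))
tWord-reduced (suc (suc (suc zero))) = from-yes (reduced? (closedWord t (suc (suc (suc zero)))))

closedWord-head : ∀ x i → head (closedWord x i) ≡ just x
closedWord-head c  zero             = refl
closedWord-head c  (suc zero)       = refl
closedWord-head c  (suc (suc zero)) = refl
closedWord-head c⁻ zero             = refl
closedWord-head c⁻ (suc zero)       = refl
closedWord-head c⁻ (suc (suc zero)) = refl
closedWord-head t  zero                   = refl
closedWord-head t  (suc zero)             = refl
closedWord-head t  (suc (suc zero))       = refl
closedWord-head t  (suc (suc (suc zero))) = refl

-- The four t-words are distinct: their second and third letters tell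
-- them apart.
tWordIndex : Word → Fin 4
tWordIndex (_ ∷ c  ∷ t ∷ _) = zero
tWordIndex (_ ∷ c⁻ ∷ t ∷ _) = suc zero
tWordIndex (_ ∷ c  ∷ _)     = suc (suc zero)
tWordIndex _                = suc (suc (suc zero))

tWord-injective : ∀ {i j} → closedWord t i ≡ closedWord t j → i ≡ j
tWord-injective {i} {j} p = trans (sym (index i)) (trans (cong tWordIndex p) (index j))
  where
  index : ∀ i → tWordIndex (closedWord t i) ≡ i
  index zero                   = refl
  index (suc zero)             = refl
  index (suc (suc zero))       = refl
  index (suc (suc (suc zero))) = refl

Listed : Word → Set
Listed w = Σ Letter λ x → Σ (Fin (count x)) λ i → w ≡ closedWord x i

∃-letter? : {Q : Letter → Set} → (∀ x → Dec (Q x)) → Dec (Σ Letter Q)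
∃-letter? q? with q? c | q? c⁻ | q? t
... | yes p | _     | _     = yes (c , p)
... | _     | yes p | _     = yes (c⁻ , p)
... | _     | _     | yes p = yes (t , p)
... | no ¬c | no ¬c⁻ | no ¬t = no λ { (c , p) → ¬c p ; (c⁻ , p) → ¬c⁻ p ; (t , p) → ¬t p }

listed? : (w : Word) → Dec (Listed w)
listed? w = ∃-letter? λ x → FinP.any? λ i → ≡-dec _≟ₗ_ w (closedWord x i)

listed-with-head : ∀ {w x} → Listed w → head w ≡ just x → Σ (Fin (count x)) λ i → w ≡ closedWord x i
listed-with-head (y , i , refl) h with trans (sym (closedWord-head y i)) h
... | refl = i , refl

listed-txty : ∀ {a x b y w} → Listed (a ∷ x ∷ b ∷ y ∷ w) → a ≡ t → b ≡ t → y ≡ inv x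
listed-txty (t , zero , refl)       refl refl = refl
listed-txty (t , suc zero , refl)   refl refl = refl
listed-txty (t , suc (suc zero) , refl)       _ ()
listed-txty (t , suc (suc (suc zero)) , refl) _ ()
listed-txty (c , zero , refl)             ()
listed-txty (c , suc zero , refl)         ()
listed-txty (c , suc (suc zero) , refl)   ()
listed-txty (c⁻ , zero , refl)            ()
listed-txty (c⁻ , suc zero , refl)        ()
listed-txty (c⁻ , suc (suc zero) , refl)  ()

module Generators (m : ℕ) where

  n : ℕ
  n = suc (suc (suc (suc m)))

  gen : Letter → Perm n
  gen c  = cycleₙ n
  gen c⁻ = cycleₙ n ⁻¹
  gen t  = trans₁₂ n

  -- eval w is the group element reached by the walk w from e; the walk w
  -- from g ends at eval w · g.
  eval : Word → Perm n
  eval []      = e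
  eval (s ∷ w) = eval w · gen s

  eval-++ : ∀ u v → eval (u ++ v) ≈ eval v · eval u
  eval-++ []      v x = refl
  eval-++ (s ∷ u) v x = cong (gen s ⟨$⟩ʳ_) (eval-++ u v x)

  open Transpositions {n}

  gen-inverse : ∀ a → gen (inv a) · gen a ≈ e
  gen-inverse c  x = inverseʳ (gen c)
  gen-inverse c⁻ x = inverseˡ (gen c)
  gen-inverse t  x = τ-involutive zero (suc zero) x

  gen-injective : ∀ a b → gen a ≈ gen b → a ≡ b
  gen-injective c  c  _ = refl
  gen-injective c⁻ c⁻ _ = refl
  gen-injective t  t  _ = refl
  gen-injective c  c⁻ p with p zero
  ... | ()
  gen-injective c⁻ c  p with p zero
  ... | ()
  gen-injective c  t  p with p (suc zero)
  ... | ()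
  gen-injective t  c  p with p (suc zero)
  ... | ()
  gen-injective c⁻ t  p with p zero
  ... | ()
  gen-injective t  c⁻ p with p zero
  ... | ()

  -- Words generate Sₙ: the letters give every transposition, and the
  -- transpositions give every permutation.
  record IsWord (π : Perm n) : Set where
    constructor _,_
    field
      word      : Word
      evaluates : π ≈ eval word

  word-≈ : {a b : Perm n} → a ≈ b → IsWord a → IsWord b
  word-≈ a≈b (w , a≈w) = w , λ x → trans (sym (a≈b x)) (a≈w x)

  word-· : {a b : Perm n} → IsWord a → IsWord b → IsWord (a · b)
  word-· {a} {b} (u , a≈u) (v , b≈v) =
    v ++ u , λ x → trans (·-cong {a = a} {a′ = eval u} {b = b} {b′ = eval v} a≈u b≈v x) (sym (eval-++ v u x))

  word-gen : ∀ s → IsWord (gen s)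
  word-gen s = s ∷ [] , λ x → refl

  -- The transposition of two neighbouring points r, r+1: conjugating by
  -- cₙ shifts both points by one, starting from (1 2) = t.
  adjacent-word : ∀ r (a b : Fin n) → toℕ a ≡ r → toℕ b ≡ suc r → IsWord (P.transpose a b)
  adjacent-word zero    zero    (suc zero)     refl refl = word-gen t
  adjacent-word zero    zero    (suc (suc _)) refl ()
  adjacent-word (suc r) (suc a) (suc b)        a≡r  b≡r =
    subst₂ (λ u v → IsWord (P.transpose u v)) (rot-inject a) (rot-inject b)
      (word-≈ shift (word-· (word-· (word-gen c⁻) shorter) (word-gen c)))
    where
    shorter : IsWord (P.transpose (inject₁ a) (inject₁ b))
    shorter = adjacent-word r (inject₁ a) (inject₁ b)
                (trans (FinP.toℕ-inject₁ a) (ℕP.suc-injective a≡r))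
                (trans (FinP.toℕ-inject₁ b) (ℕP.suc-injective b≡r))
    shift : (gen c⁻ · P.transpose (inject₁ a) (inject₁ b)) · gen c
            ≈ P.transpose (rot (inject₁ a)) (rot (inject₁ b))
    shift = τ-conjugate rot unrot rot-unrot unrot-rot (inject₁ a) (inject₁ b)

  -- The transposition of a and b = a+d+1: conjugate the transposition of
  -- a and b−1 by the transposition of the neighbours b−1 and b.
  spread-word : ∀ d (a b : Fin n) → toℕ b ≡ suc (d + toℕ a) → IsWord (P.transpose a b)
  spread-word zero    a b       b≡a+1 = adjacent-word (toℕ a) a b refl b≡a+1
  spread-word (suc d) a (suc y) b≡a+d = word-≈ conjugate (word-· (word-· step shorter) step)
    where
    y′ : Fin n
    y′ = inject₁ y
    step : IsWord (P.transpose y′ (suc y))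
    step = adjacent-word (toℕ y′) y′ (suc y) refl (cong suc (sym (FinP.toℕ-inject₁ y)))
    y′≡a+d : toℕ y′ ≡ suc (d + toℕ a)
    y′≡a+d = trans (FinP.toℕ-inject₁ y) (ℕP.suc-injective b≡a+d)
    shorter : IsWord (P.transpose a y′)
    shorter = spread-word d a y′ y′≡a+d
    farther : ∀ {x} k → toℕ x ≡ suc (k + toℕ a) → a ≢ x
    farther k x≡ refl = ℕP.m≢1+n+m (toℕ a) x≡
    conjugate : (P.transpose y′ (suc y) · P.transpose a y′) · P.transpose y′ (suc y)
                ≈ P.transpose a (suc y)
    conjugate x = trans (τ-conjugate-τ y′ (suc y) a y′ x)
      (cong₂ (λ u v → τ u v x)
        (τ-fix y′ (suc y) a (farther d y′≡a+d) (farther (suc d) b≡a+d))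
        (τ-left y′ (suc y)))

  ordered-word : ∀ a b → toℕ a ℕ.< toℕ b → IsWord (P.transpose a b)
  ordered-word a b a<b = spread-word (toℕ b ∸ suc (toℕ a)) a b distance
    where
    distance : toℕ b ≡ suc ((toℕ b ∸ suc (toℕ a)) + toℕ a)
    distance = sym (trans (sym (ℕP.+-suc (toℕ b ∸ suc (toℕ a)) (toℕ a))) (ℕP.m∸n+n≡m a<b))

  transposition-word : ∀ a b → IsWord (P.transpose a b)
  transposition-word a b with ℕP.<-cmp (toℕ a) (toℕ b)
  ... | tri< a<b _ _ = ordered-word a b a<b
  ... | tri≈ _ a≡b _ rewrite FinP.toℕ-injective a≡b =
    word-≈ {a = e} (λ x → sym (τ-self b x)) ([] , λ x → refl)
  ... | tri> _ _ b<a = word-≈ (λ x → τ-sym b a x) (ordered-word b a b<a)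

  every-permutation-word : ∀ π → IsWord π
  every-permutation-word π = word-≈ (TL.eval-decompose π) (product (TL.decompose π))
    where
    product : (xs : TranspositionList n) → IsWord (TL.eval xs)
    product []             = [] , λ x → refl
    product ((a , b) ∷ xs) = word-· (transposition-word a b) (product xs)

  -- The four t-words are closed: each is the square or cube of a short
  -- block whose evaluation is a product of two transpositions.
  rot-conjugate : ∀ a b x → rot (τ a b (unrot x)) ≡ τ (rot a) (rot b) x
  rot-conjugate = τ-conjugate rot unrot rot-unrot unrot-rot

  unrot-conjugate : ∀ a b x → unrot (τ a b (rot x)) ≡ τ (unrot a) (unrot b) x
  unrot-conjugate = τ-conjugate unrot rot unrot-rot rot-unrot

  closed-square : ∀ u (ρ : Perm n) → eval u ≈ ρ → ρ · ρ ≈ e → eval (u ++ u) ≈ e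
  closed-square u ρ u≈ρ ρ²≈e x = begin
    eval (u ++ u) ⟨$⟩ʳ x ≡⟨ eval-++ u u x ⟩
    U (U x)              ≡⟨ cong U (u≈ρ x) ⟩
    U (ρ ⟨$⟩ʳ x)         ≡⟨ u≈ρ _ ⟩
    ρ ⟨$⟩ʳ (ρ ⟨$⟩ʳ x)    ≡⟨ ρ²≈e x ⟩
    x                    ∎
    where
    open ≡-Reasoning
    U : Fin n → Fin n
    U = eval u ⟨$⟩ʳ_

  closed-cube : ∀ u (ρ : Perm n) → eval u ≈ ρ → ρ · ρ · ρ ≈ e → eval (u ++ u ++ u) ≈ e
  closed-cube u ρ u≈ρ ρ³≈e x = begin
    eval (u ++ u ++ u) ⟨$⟩ʳ x     ≡⟨ eval-++ u (u ++ u) x ⟩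
    U (eval (u ++ u) ⟨$⟩ʳ x)      ≡⟨ cong U (closed-square-free x) ⟩
    U (R (R x))                   ≡⟨ u≈ρ _ ⟩
    R (R (R x))                   ≡⟨ ρ³≈e x ⟩
    x                             ∎
    where
    open ≡-Reasoning
    U R : Fin n → Fin n
    U = eval u ⟨$⟩ʳ_
    R = ρ ⟨$⟩ʳ_
    closed-square-free : ∀ x → eval (u ++ u) ⟨$⟩ʳ x ≡ R (R x)
    closed-square-free x = trans (eval-++ u u x) (trans (cong U (u≈ρ x)) (u≈ρ _))

  tWord-closed : ∀ i → eval (closedWord t i) ≈ e
  tWord-closed zero =
    closed-cube (t ∷ c ∷ t ∷ c⁻ ∷ []) (P.transpose 1F 2F · P.transpose 0F 1F)
      (λ x → cong (τ 0F 1F) (rot-conjugate 0F 1F x))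
      (overlapping-cube 0F 1F 2F (λ ()) (λ ()) (λ ()))
  tWord-closed (suc zero) =
    closed-cube (t ∷ c⁻ ∷ t ∷ c ∷ []) (P.transpose 0F (unrot 0F) · P.transpose 1F 0F)
      (λ x → trans (τ-sym 0F 1F (unrot (τ 0F 1F (rot x))))
                   (cong (τ 1F 0F) (trans (unrot-conjugate 0F 1F x) (τ-sym (unrot 0F) 0F x))))
      (overlapping-cube 1F 0F (unrot 0F) (λ ()) (λ ()) (λ ()))
  tWord-closed (suc (suc zero)) =
    closed-square (t ∷ c ∷ c ∷ t ∷ c⁻ ∷ c⁻ ∷ []) (P.transpose 2F 3F · P.transpose 0F 1F)
      (λ x → cong (τ 0F 1F) (trans (cong rot (rot-conjugate 0F 1F (unrot x))) (rot-conjugate 1F 2F x)))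
      (disjoint-square 0F 1F 2F 3F (λ ()) (λ ()) (λ ()) (λ ()))
  tWord-closed (suc (suc (suc zero))) =
    closed-square (t ∷ c⁻ ∷ c⁻ ∷ t ∷ c ∷ c ∷ [])
      (P.transpose (unrot (unrot 0F)) (unrot 0F) · P.transpose 0F 1F)
      (λ x → cong (τ 0F 1F) (trans (cong unrot (unrot-conjugate 0F 1F (rot x)))
                                     (unrot-conjugate (unrot 0F) 0F x)))
      (disjoint-square 0F 1F (unrot (unrot 0F)) (unrot 0F) (λ ()) (λ ()) (λ ()) (λ ()))

rot-< : ∀ {m} (i : Fin (suc m)) → toℕ i ℕ.< m → toℕ (rot i) ≡ suc (toℕ i)
rot-< {suc m} zero    _         = refl
rot-< {suc m} (suc i) (s≤s i<m) with rot i | rot-< i i<m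
... | suc j | j≡ = cong suc j≡

rot-last-ℕ : ∀ {m} (i : Fin (suc m)) → toℕ i ≡ m → toℕ (rot i) ≡ 0
rot-last-ℕ {zero}  zero    _   = refl
rot-last-ℕ {suc m} (suc i) i≡m with rot i | rot-last-ℕ i (ℕP.suc-injective i≡m)
... | zero | _ = refl

-- A word of length 12 only moves points at cyclic distance
-- ≤ 12 from 0, so it is evaluated symbolically on landmarks: the point i
-- counted from the start, or the point (n−1)−j counted from the end.  A
-- word that is not listed visibly moves one of six probe points.
module Classification (k : ℕ) where

  open Generators (9 + k) public

  last : ℕ
  last = 12 + k

  data Landmark : Set where
    start end : ℕ → Landmark

  At : Landmark → Fin n → Set
  At (start i) x = toℕ x ≡ i
  At (end j)   x = toℕ x ≡ last ∸ j

  -- The action of a letter on landmarks, where it is certainly exact: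
  -- start 0…12 and end 0…11; nothing once a landmark may leave these.
  move : Letter → Landmark → Maybe Landmark
  move c (start i) with i ℕ.<? 12
  ... | yes _ = just (start (suc i))
  ... | no _  = nothing
  move c (end zero) = just (start zero)
  move c (end (suc j)) with j ℕ.<? 11
  ... | yes _ = just (end j)
  ... | no _  = nothing
  move c⁻ (start zero)    = just (end zero)
  move c⁻ (start (suc i)) = just (start i)
  move c⁻ (end j) with j ℕ.<? 10
  ... | yes _ = just (end (suc j))
  ... | no _  = nothing
  move t (start zero)             = just (start (suc zero))
  move t (start (suc zero))       = just (start zero)
  move t (start (suc (suc i)))    = just (start (suc (suc i)))
  move t (end j) with j ℕ.<? 11
  ... | yes _ = just (end j)
  ... | no _  = nothing

  two≤end : ∀ j → j ℕ.< 11 → 2 ℕ.≤ last ∸ j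
  two≤end j j<11 = ℕP.m+n≤o⇒m≤o∸n 2 (ℕP.≤-trans (s≤s j<11) (ℕP.m≤m+n 12 k))

  end-is-suc : ∀ j → j ℕ.< 11 → ∀ (x : Fin n) → toℕ x ≡ last ∸ j → Σ (Fin last) λ y → x ≡ suc y
  end-is-suc j j<11 zero    x≡ with two≤end j j<11
  ... | le rewrite sym x≡ with le
  ... | ()
  end-is-suc j j<11 (suc y) x≡ = y , refl

  suc-last∸ : ∀ j → suc j ℕ.≤ last → suc (last ∸ suc j) ≡ last ∸ j
  suc-last∸ j j<last = sym (ℕP.+-∸-assoc 1 j<last)

  move-sound : ∀ s P Q (x : Fin n) → move s P ≡ just Q → At P x → At Q (gen s ⟨$⟩ʳ x)
  move-sound c (start i) Q x eq d with i ℕ.<? 12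
  move-sound c (start i) .(start (suc i)) x refl d | yes h =
    trans (rot-< x (subst (ℕ._< last) (sym d) (ℕP.≤-trans h (ℕP.m≤m+n 12 k)))) (cong suc d)
  move-sound c (start i) Q x () d | no _
  move-sound c (end zero) .(start zero) x refl d = rot-last-ℕ x d
  move-sound c (end (suc j)) Q x eq d with j ℕ.<? 11
  move-sound c (end (suc j)) .(end j) x refl d | yes h =
    trans (rot-< x (subst (ℕ._< last) (sym d) (ℕP.∸-monoʳ-< {last} {suc j} {0} (s≤s z≤n) j<last)))
          (trans (cong suc d) (suc-last∸ j j<last))
    where
    j<last : suc j ℕ.≤ last
    j<last = ℕP.≤-trans h (ℕP.m≤m+n 11 (suc k))
  move-sound c (end (suc j)) Q x () d | no _
  move-sound c⁻ (start zero) .(end zero) zero refl d = FinP.toℕ-fromℕ last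
  move-sound c⁻ (start (suc i)) .(start i) (suc y) refl d = trans (FinP.toℕ-inject₁ y) (ℕP.suc-injective d)
  move-sound c⁻ (end j) Q x eq d with j ℕ.<? 10
  move-sound c⁻ (end j) .(end (suc j)) x refl d | yes h with end-is-suc j (ℕP.≤-trans h (ℕP.n≤1+n 10)) x d
  ... | y , refl = trans (FinP.toℕ-inject₁ y)
                     (ℕP.suc-injective (trans d (sym (suc-last∸ j (ℕP.≤-trans h (ℕP.m≤m+n 10 (suc (suc k))))))))
  move-sound c⁻ (end j) Q x () d | no _
  move-sound t (start zero) .(start (suc zero)) zero refl d = refl
  move-sound t (start (suc zero)) .(start zero) (suc zero) refl d = refl
  move-sound t (start (suc (suc i))) .(start (suc (suc i))) (suc (suc y)) refl d = d
  move-sound t (end j) Q x eq d with j ℕ.<? 11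
  move-sound t (end j) .(end j) x refl d | yes h with end-is-suc j h x d
  move-sound t (end j) .(end j) .(suc zero) refl d | yes h | zero , refl with two≤end j h
  ... | le rewrite sym d with le
  ... | s≤s ()
  move-sound t (end j) .(end j) .(suc (suc y)) refl d | yes h | suc y , refl = d
  move-sound t (end j) Q x () d | no _

  -- The action of a whole word (its last letter acts first).
  moveWord : Word → Landmark → Maybe Landmark
  moveWord []      P = just P
  moveWord (s ∷ w) P with moveWord w P
  ... | nothing = nothing
  ... | just Q  = move s Q

  moveWord-sound : ∀ w P Q (x : Fin n) → moveWord w P ≡ just Q → At P x → At Q (eval w ⟨$⟩ʳ x)
  moveWord-sound []      P .P x refl d = d
  moveWord-sound (s ∷ w) P Q  x eq   d with moveWord w P | moveWord-sound w P
  ... | just R  | sound = move-sound s R Q (eval w ⟨$⟩ʳ x) eq (sound R x refl d)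
  ... | nothing | _     with eq
  ...   | ()

  apart : Landmark → Landmark → Bool
  apart (start i) (start i′) with i ℕ.≟ i′
  ... | yes _ = false
  ... | no _  = true
  apart (end j) (end j′) with j ℕ.≟ j′ | j ℕ.<? 12 | j′ ℕ.<? 12
  ... | no _ | yes _ | yes _ = true
  ... | _    | _     | _     = false
  apart (start i) (end j) with i + j ℕ.<? 12
  ... | yes _ = true
  ... | no _  = false
  apart (end j) (start i) with i + j ℕ.<? 12
  ... | yes _ = true
  ... | no _  = false

  start≢end : ∀ i j → i + j ℕ.< 12 → i ≢ last ∸ j
  start≢end i j small i≡ = ℕP.<-irrefl refl (ℕP.<-≤-trans small (ℕP.≤-trans (ℕP.m≤m+n 12 k)
    (subst (last ℕ.≤_) (trans (cong (j +_) (sym i≡)) (ℕP.+-comm j i)) (ℕP.m≤n+m∸n last j))))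

  apart-sound : ∀ P Q (x : Fin n) → T (apart P Q) → At P x → At Q x → ⊥
  apart-sound (start i) (start i′) x h d d′ with i ℕ.≟ i′
  ... | no i≢i′ = i≢i′ (trans (sym d) d′)
  apart-sound (end j) (end j′) x h d d′ with j ℕ.≟ j′ | j ℕ.<? 12 | j′ ℕ.<? 12
  ... | no j≢j′ | yes j<12 | yes j′<12 =
    j≢j′ (ℕP.∸-cancelˡ-≡ (below j<12) (below j′<12) (trans (sym d) d′))
    where
    below : ∀ {i} → i ℕ.< 12 → i ℕ.≤ last
    below i<12 = ℕP.≤-trans (ℕP.<⇒≤ i<12) (ℕP.m≤m+n 12 k)
  apart-sound (start i) (end j) x h d d′ with i + j ℕ.<? 12
  ... | yes small = start≢end i j small (trans (sym d) d′)
  apart-sound (end j) (start i) x h d d′ with i + j ℕ.<? 12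
  ... | yes small = start≢end i j small (trans (sym d′) d)

  moves : Landmark → Word → Bool
  moves P w with moveWord w P
  ... | nothing = false
  ... | just Q  = apart P Q

  moves-sound : ∀ P w (x : Fin n) → T (moves P w) → At P x → ¬ (eval w ≈ e)
  moves-sound P w x h d closed with moveWord w P | moveWord-sound w P
  ... | just Q | sound = apart-sound P Q x h d (subst (At Q) (closed x) (sound Q x refl d))

  record Probe : Set where
    constructor probe
    field
      landmark : Landmark
      point    : Fin n
      located  : At landmark point

  probes : List Probe
  probes = probe (end 2) (inject₁ (inject₁ (fromℕ (10 + k))))
                 (trans (FinP.toℕ-inject₁ _) (trans (FinP.toℕ-inject₁ _) (FinP.toℕ-fromℕ (10 + k))))
         ∷ probe (start 0) 0F refl ∷ probe (start 3) 3F refl ∷ probe (end 0) (fromℕ last) (FinP.toℕ-fromℕ last)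
         ∷ probe (start 4) (suc 3F) refl ∷ probe (start 1) 1F refl ∷ []

  movesSomeProbe : List Probe → Word → Bool
  movesSomeProbe []       w = false
  movesSomeProbe (p ∷ ps) w = moves (Probe.landmark p) w ∨ movesSomeProbe ps w

  movesSomeProbe-sound : ∀ ps w → T (movesSomeProbe ps w) → ¬ (eval w ≈ e)
  movesSomeProbe-sound (probe P x d ∷ ps) w h with Equivalence.to (T-∨ {moves P w}) h
  ... | inj₁ moved = moves-sound P w x moved d
  ... | inj₂ later = movesSomeProbe-sound ps w later

  -- Every reduced word of length 12 is listed or moves a probe (checked by
  -- evaluation), hence every closed one is listed.
  accounted : Word → Bool
  accounted w = isYes (listed? w) ∨ movesSomeProbe probes w

  all-accounted : ∀ x → T (allReducedFrom 11 x accounted)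
  all-accounted c  = _
  all-accounted c⁻ = _
  all-accounted t  = _

  closed-listed : ∀ w → length w ≡ 12 → Reduced w → eval w ≈ e → Listed w
  closed-listed (x ∷ v) len red closed
    with Equivalence.to (T-∨ {isYes (listed? (x ∷ v))})
           (allReducedFrom-sound 11 x accounted (all-accounted x) v (ℕP.suc-injective len) red)
  ... | inj₁ listed = toWitness {a? = listed? (x ∷ v)} listed
  ... | inj₂ moved  = ⊥-elim (movesSomeProbe-sound probes (x ∷ v) moved closed)

module Labelling (m : ℕ) (σ : Perm (4 + m) → Perm (4 + m)) (σ-aut : IsGraphAut (4 + m) σ) where

  open Generators m

  σ-cong : {x y : Perm n} → x ≈ y → σ x ≈ σ y
  σ-cong = proj₁ (proj₁ σ-aut)

  σ-injective : ∀ x y → σ x ≈ σ y → x ≈ y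
  σ-injective = proj₁ (proj₂ (proj₁ σ-aut))

  letter-in-S : ∀ {x} s → x ≈ gen s → InS n x
  letter-in-S c  p = inj₁ p
  letter-in-S c⁻ p = inj₂ (inj₁ p)
  letter-in-S t  p = inj₂ (inj₂ p)

  letter-of-S : ∀ {x} → InS n x → Σ Letter λ s → x ≈ gen s
  letter-of-S (inj₁ p)        = c , p
  letter-of-S (inj₂ (inj₁ p)) = c⁻ , p
  letter-of-S (inj₂ (inj₂ p)) = t , p

  edge-image : ∀ g s → Σ Letter λ s′ → σ (gen s · g) ≈ gen s′ · σ g
  edge-image g s = s′ , ·⁻¹⇒· {a = σ (gen s · g)} {b = gen s′} (σ g) (proj₂ image)
    where
    adjacent : Adj n g (gen s · g)
    adjacent = letter-in-S {x = (gen s · g) · g ⁻¹} s (·⇒·⁻¹ {a = gen s · g} {b = gen s} g (λ x → refl))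
    image : Σ Letter λ s′ → σ (gen s · g) · σ g ⁻¹ ≈ gen s′
    image = letter-of-S {x = σ (gen s · g) · σ g ⁻¹} (Equivalence.to (proj₂ σ-aut g (gen s · g)) adjacent)
    s′ : Letter
    s′ = proj₁ image

  label : Perm n → Letter → Letter
  label g s = proj₁ (edge-image g s)

  label-spec : ∀ g s → σ (gen s · g) ≈ gen (label g s) · σ g
  label-spec g s = proj₂ (edge-image g s)

  label-unique : ∀ g s x → σ (gen s · g) ≈ gen x · σ g → x ≡ label g s
  label-unique g s x p = gen-injective x (label g s)
    (·-cancelʳ {a = gen x} {b = gen (label g s)} (σ g) (λ y → trans (sym (p y)) (label-spec g s y)))

  label-cong : ∀ g h s → g ≈ h → label g s ≡ label h s
  label-cong g h s g≈h = label-unique h s (label g s) λ y → begin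
    σ (gen s · h) ⟨$⟩ʳ y                  ≡⟨ σ-cong {gen s · h} {gen s · g} (λ z → sym (g≈h _)) y ⟩
    σ (gen s · g) ⟨$⟩ʳ y                  ≡⟨ label-spec g s y ⟩
    σ g ⟨$⟩ʳ (gen (label g s) ⟨$⟩ʳ y)     ≡⟨ σ-cong {g} {h} g≈h _ ⟩
    σ h ⟨$⟩ʳ (gen (label g s) ⟨$⟩ʳ y)     ∎
    where open ≡-Reasoning

  label-injective : ∀ g s₁ s₂ → label g s₁ ≡ label g s₂ → s₁ ≡ s₂
  label-injective g s₁ s₂ p = gen-injective s₁ s₂ (·-cancelʳ {a = gen s₁} {b = gen s₂} g
    (σ-injective (gen s₁ · g) (gen s₂ · g) λ y →
      trans (label-spec g s₁ y)
            (trans (cong (λ z → σ g ⟨$⟩ʳ (gen z ⟨$⟩ʳ y)) p) (sym (label-spec g s₂ y)))))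

  label-inv : ∀ g s → label (gen s · g) (inv s) ≡ inv (label g s)
  label-inv g s = sym (label-unique (gen s · g) (inv s) (inv s′) λ y → begin
    σ (gen (inv s) · (gen s · g)) ⟨$⟩ʳ y        ≡⟨ σ-cong {gen (inv s) · (gen s · g)} {g}
                                                      (λ x → cong (g ⟨$⟩ʳ_) (gen-inverse s x)) y ⟩
    σ g ⟨$⟩ʳ y                                  ≡⟨ cong (σ g ⟨$⟩ʳ_) (sym (gen-inverse s′ y)) ⟩
    σ g ⟨$⟩ʳ (gen s′ ⟨$⟩ʳ (gen (inv s′) ⟨$⟩ʳ y)) ≡⟨ sym (label-spec g s _) ⟩
    σ (gen s · g) ⟨$⟩ʳ (gen (inv s′) ⟨$⟩ʳ y)    ∎)
    where
    open ≡-Reasoning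
    s′ : Letter
    s′ = label g s

  transport : Perm n → Word → Word
  transport g []      = []
  transport g (s ∷ w) = label g s ∷ transport (gen s · g) w

  transport-eval : ∀ w g → σ (eval w · g) ≈ eval (transport g w) · σ g
  transport-eval []      g = σ-cong {e · g} {g} (λ x → refl)
  transport-eval (s ∷ w) g y = begin
    σ (eval (s ∷ w) · g) ⟨$⟩ʳ y                     ≡⟨ σ-cong {eval (s ∷ w) · g} {eval w · (gen s · g)}
                                                          (λ x → refl) y ⟩
    σ (eval w · (gen s · g)) ⟨$⟩ʳ y                 ≡⟨ transport-eval w (gen s · g) y ⟩
    σ (gen s · g) ⟨$⟩ʳ (eval (transport (gen s · g) w) ⟨$⟩ʳ y)
                                                    ≡⟨ label-spec g s _ ⟩
    σ g ⟨$⟩ʳ (eval (transport g (s ∷ w)) ⟨$⟩ʳ y)    ∎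
    where open ≡-Reasoning

  transport-closed : ∀ w g → eval w ≈ e → eval (transport g w) ≈ e
  transport-closed w g closed = ·-cancelʳ {a = eval (transport g w)} {b = e} (σ g) λ y →
    trans (sym (transport-eval w g y)) (σ-cong {eval w · g} {g} (λ x → cong (g ⟨$⟩ʳ_) (closed x)) y)

  transport-length : ∀ w g → length (transport g w) ≡ length w
  transport-length []      g = refl
  transport-length (s ∷ w) g = cong suc (transport-length w (gen s · g))

  transport-reduced : ∀ w g → Reduced w → Reduced (transport g w)
  transport-reduced []          g []  = []
  transport-reduced (s ∷ [])    g [-] = [-]
  transport-reduced (s ∷ r ∷ w) g (r≢s⁻ ∷ red) = no-return ∷ transport-reduced (r ∷ w) (gen s · g) red
    where
    no-return : label (gen s · g) r ≢ inv (label g s)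
    no-return eq = r≢s⁻ (label-injective (gen s · g) r (inv s) (trans eq (sym (label-inv g s))))

  transport-injective : ∀ w₁ w₂ g → transport g w₁ ≡ transport g w₂ → w₁ ≡ w₂
  transport-injective []         []         g _  = refl
  transport-injective []         (_ ∷ _)    g ()
  transport-injective (_ ∷ _)    []         g ()
  transport-injective (s₁ ∷ w₁) (s₂ ∷ w₂) g p with label-injective g s₁ s₂ (∷-injectiveˡ p)
  ... | refl = cong (s₁ ∷_) (transport-injective w₁ w₂ (gen s₁ · g) (∷-injectiveʳ p))

  head-transport : ∀ g w → head (transport g w) ≡ Maybe.map (label g) (head w)
  head-transport g []      = refl
  head-transport g (s ∷ w) = refl

module Normality (k : ℕ) (σ : Perm (13 + k) → Perm (13 + k)) (σ-aut : InAutΓₑ (13 + k) σ) where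

  open Classification k
  open Labelling (9 + k) σ (proj₁ σ-aut)

  transported-tWord-listed : ∀ g i → Listed (transport g (closedWord t i))
  transported-tWord-listed g i = closed-listed (transport g (closedWord t i))
    (trans (transport-length (closedWord t i) g) (tWord-length i))
    (transport-reduced (closedWord t i) g (tWord-reduced i))
    (transport-closed (closedWord t i) g (tWord-closed i))

  -- The four images are distinct listed words beginning with label g t;
  -- only t begins four listed words.
  label-t : ∀ g → label g t ≡ t
  label-t g = four-words (label g t) (FinP.injective⇒≤ {f = λ i → proj₁ (position i)} distinct)
    where
    position : ∀ i → Σ (Fin (count (label g t))) λ j → transport g (closedWord t i) ≡ closedWord (label g t) j
    position i = listed-with-head (transported-tWord-listed g i)
      (trans (head-transport g (closedWord t i)) (cong (Maybe.map (label g)) (closedWord-head t i)))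
    distinct : ∀ {i j} → proj₁ (position i) ≡ proj₁ (position j) → i ≡ j
    distinct {i} {j} p = tWord-injective (transport-injective (closedWord t i) (closedWord t j) g
      (trans (proj₂ (position i)) (trans (cong (closedWord (label g t)) p) (sym (proj₂ (position j))))))

  sign : Perm n → Letter
  sign g = label g c

  sign-cong : ∀ g h → g ≈ h → sign g ≡ sign h
  sign-cong g h = label-cong g h c

  sign≢t : ∀ g → sign g ≢ t
  sign≢t g eq with label-injective g c t (trans eq (sym (label-t g)))
  ... | ()

  label-c⁻ : ∀ g → label g c⁻ ≡ inv (sign g)
  label-c⁻ g = other-rotation (sign≢t g) c⁻-label≢t c-label≢c⁻-label
    where
    c⁻-label≢t : label g c⁻ ≢ t
    c⁻-label≢t eq with label-injective g c⁻ t (trans eq (sym (label-t g)))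
    ... | ()
    c-label≢c⁻-label : sign g ≢ label g c⁻
    c-label≢c⁻-label eq with label-injective g c c⁻ eq
    ... | ()

  sign-c : ∀ g → sign (gen c · g) ≡ sign g
  sign-c g = inv-injective (trans (sym (label-c⁻ (gen c · g))) (label-inv g c))

  sign-c⁻ : ∀ g → sign (gen c⁻ · g) ≡ sign g
  sign-c⁻ g = trans (label-inv g c⁻) (trans (cong inv (label-c⁻ g)) (inv-involutive (sign g)))

  -- Along the walk t c t c⁻ … from h, the listed image has the form
  -- t x t x⁻¹ …, which compares the signs at t·h and t·c·t·h.
  sign-tct : ∀ h → sign (gen t · (gen c · (gen t · h))) ≡ sign (gen t · h)
  sign-tct h = inv-injective (trans (sym (label-c⁻ (gen t · (gen c · (gen t · h)))))
    (listed-txty (transported-tWord-listed h zero) (label-t h) (label-t (gen c · (gen t · h)))))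

  sign-tc : ∀ g → sign (gen t · (gen c · g)) ≡ sign g
  sign-tc g = begin
    sign (gen t · (gen c · g))                     ≡⟨ sign-cong (gen t · (gen c · g)) (gen t · (gen c · (gen t · (gen t · g))))
                                                        (λ x → cong (g ⟨$⟩ʳ_) (sym (gen-inverse t (gen c ⟨$⟩ʳ (gen t ⟨$⟩ʳ x))))) ⟩
    sign (gen t · (gen c · (gen t · (gen t · g)))) ≡⟨ sign-tct (gen t · g) ⟩
    sign (gen t · (gen t · g))                     ≡⟨ sign-cong (gen t · (gen t · g)) g
                                                        (λ x → cong (g ⟨$⟩ʳ_) (gen-inverse t x)) ⟩
    sign g                                         ∎
    where open ≡-Reasoning

  sign-t : ∀ g → sign (gen t · g) ≡ sign g
  sign-t g = begin
    sign (gen t · g)                      ≡⟨ sign-cong (gen t · g) (gen t · (gen c · (gen c⁻ · g)))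
                                               (λ x → cong (g ⟨$⟩ʳ_) (sym (gen-inverse c⁻ (gen t ⟨$⟩ʳ x)))) ⟩
    sign (gen t · (gen c · (gen c⁻ · g))) ≡⟨ sign-tc (gen c⁻ · g) ⟩
    sign (gen c⁻ · g)                     ≡⟨ sign-c⁻ g ⟩
    sign g                                ∎
    where open ≡-Reasoning

  sign-step : ∀ s g → sign (gen s · g) ≡ sign g
  sign-step c  = sign-c
  sign-step c⁻ = sign-c⁻
  sign-step t  = sign-t

  -- Γₙ is connected, so the sign is constant.
  sign-eval : ∀ w g → sign (eval w · g) ≡ sign g
  sign-eval []      g = sign-cong (e · g) g (λ x → refl)
  sign-eval (s ∷ w) g = trans (sign-cong (eval (s ∷ w) · g) (eval w · (gen s · g)) (λ x → refl))
                              (trans (sign-eval w (gen s · g)) (sign-step s g))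

  sign-constant : ∀ g → sign g ≡ sign e
  sign-constant g = sign-of-word (every-permutation-word g)
    where
    sign-of-word : ∀ {h} → IsWord h → sign h ≡ sign e
    sign-of-word {h} (w , h≈w) = trans (sign-cong h (eval w · e) h≈w) (sign-eval w e)

  φ : Letter → Letter
  φ = relabel (sign e)

  label-global : ∀ g s → label g s ≡ φ s
  label-global g c  = sign-constant g
  label-global g c⁻ = trans (label-c⁻ g) (cong inv (sign-constant g))
  label-global g t  = label-t g

  transport-global : ∀ w g → transport g w ≡ map φ w
  transport-global []      g = refl
  transport-global (s ∷ w) g = cong₂ _∷_ (label-global g s) (transport-global w (gen s · g))

  σ-eval : ∀ w g → σ (eval w · g) ≈ eval (map φ w) · σ g
  σ-eval w g y = trans (transport-eval w g y)
                       (cong (λ v → σ g ⟨$⟩ʳ (eval v ⟨$⟩ʳ y)) (transport-global w g))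

  σ-word : ∀ w → σ (eval w) ≈ eval (map φ w)
  σ-word w y = trans (σ-cong {eval w} {eval w · e} (λ x → refl) y) (trans (σ-eval w e y) (proj₂ σ-aut _))

  σ-homomorphism : ∀ x g → σ (x · g) ≈ σ x · σ g
  σ-homomorphism x g = on-word (every-permutation-word x)
    where
    open ≡-Reasoning
    on-word : IsWord x → σ (x · g) ≈ σ x · σ g
    on-word (w , x≈w) y = begin
      σ (x · g) ⟨$⟩ʳ y                    ≡⟨ σ-cong {x · g} {eval w · g} (λ z → cong (g ⟨$⟩ʳ_) (x≈w z)) y ⟩
      σ (eval w · g) ⟨$⟩ʳ y               ≡⟨ σ-eval w g y ⟩
      σ g ⟨$⟩ʳ (eval (map φ w) ⟨$⟩ʳ y)    ≡⟨ cong (σ g ⟨$⟩ʳ_) (sym (trans (σ-cong {x} {eval w} x≈w y) (σ-word w y))) ⟩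
      σ g ⟨$⟩ʳ (σ x ⟨$⟩ʳ y)               ∎

  σ-gen : ∀ a → σ (gen a) ≈ gen (φ a)
  σ-gen a = σ-word (a ∷ [])

  σ-maps-S : MapsSOntoS n σ
  σ-maps-S = into , onto
    where
    into : ∀ s → InS n s → InS n (σ s)
    into s s∈S with letter-of-S {x = s} s∈S
    ... | a , s≈a = letter-in-S {x = σ s} (φ a) (λ y → trans (σ-cong {s} {gen a} s≈a y) (σ-gen a y))
    onto : ∀ s → InS n s → ∃ λ u → InS n u × (σ u ≈ s)
    onto s s∈S with letter-of-S {x = s} s∈S
    ... | a , s≈a = gen (φ a) , letter-in-S {x = gen (φ a)} (φ a) (λ y → refl) ,
      λ y → trans (σ-gen (φ a) y)
                  (trans (cong (λ b → gen b ⟨$⟩ʳ y) (relabel-involutive (sign e) (sign≢t e) a)) (sym (s≈a y)))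

  is-group-aut : InAutGS n σ
  is-group-aut = (proj₁ (proj₁ σ-aut) , σ-homomorphism) , σ-maps-S

-- Conversely, for every n, an automorphism f of Sₙ with S^f = S fixes e and
-- preserves adjacency, since (h·g⁻¹)^f = h^f·(g^f)⁻¹.
module GroupAutomorphism {n : ℕ} (f : Perm n → Perm n) (f-aut : InAutGS n f) where

  f-cong : {x y : Perm n} → x ≈ y → f x ≈ f y
  f-cong = proj₁ (proj₁ (proj₁ f-aut))

  f-injective : ∀ x y → f x ≈ f y → x ≈ y
  f-injective = proj₁ (proj₂ (proj₁ (proj₁ f-aut)))

  f-hom : ∀ x y → f (x · y) ≈ f x · f y
  f-hom = proj₂ (proj₁ f-aut)

  InS-resp-≈ : ∀ {a b} → a ≈ b → InS n a → InS n b
  InS-resp-≈ a≈b (inj₁ p)        = inj₁ (λ y → trans (sym (a≈b y)) (p y))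
  InS-resp-≈ a≈b (inj₂ (inj₁ p)) = inj₂ (inj₁ (λ y → trans (sym (a≈b y)) (p y)))
  InS-resp-≈ a≈b (inj₂ (inj₂ p)) = inj₂ (inj₂ (λ y → trans (sym (a≈b y)) (p y)))

  f-e : f e ≈ e
  f-e = ·-cancelʳ {a = f e} {b = e} (f e) λ y → sym (trans (f-cong {e} {e · e} (λ x → refl) y) (f-hom e e y))

  f-inverse : ∀ g → f (g ⁻¹) ≈ f g ⁻¹
  f-inverse g y = trans (cong (f (g ⁻¹) ⟨$⟩ʳ_) (sym (inverseʳ (f g)))) (left-inverse (f g ⟨$⟩ˡ y))
    where
    left-inverse : ∀ z → f (g ⁻¹) ⟨$⟩ʳ (f g ⟨$⟩ʳ z) ≡ z
    left-inverse z = trans (sym (f-hom g (g ⁻¹) z)) (trans (f-cong {g · g ⁻¹} {e} (·-inverseʳ g) z) (f-e z))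

  f-quotient : ∀ g h → f (h · g ⁻¹) ≈ f h · f g ⁻¹
  f-quotient g h y = trans (f-hom h (g ⁻¹) y) (f-inverse g (f h ⟨$⟩ʳ y))

  preserves-adjacency : ∀ g h → Adj n g h → Adj n (f g) (f h)
  preserves-adjacency g h adj =
    InS-resp-≈ {f (h · g ⁻¹)} {f h · f g ⁻¹} (f-quotient g h) (proj₁ (proj₂ f-aut) (h · g ⁻¹) adj)

  reflects-adjacency : ∀ g h → Adj n (f g) (f h) → Adj n g h
  reflects-adjacency g h adj with proj₂ (proj₂ f-aut) (f (h · g ⁻¹))
                                   (InS-resp-≈ {f h · f g ⁻¹} {f (h · g ⁻¹)} (λ y → sym (f-quotient g h y)) adj)
  ... | u , u∈S , fu≈ = InS-resp-≈ {u} {h · g ⁻¹} (f-injective u (h · g ⁻¹) fu≈) u∈S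

  is-graph-aut : InAutΓₑ n f
  is-graph-aut = (proj₁ (proj₁ f-aut) , λ g h → mk⇔ (preserves-adjacency g h) (reflects-adjacency g h)) , f-e

normal-13+ : ∀ k (f : Perm (13 + k) → Perm (13 + k)) → InAutΓₑ (13 + k) f ⇔ InAutGS (13 + k) f
normal-13+ k f = mk⇔ (Normality.is-group-aut k f) (GroupAutomorphism.is-graph-aut f)

lemma2p6 : (n : ℕ) → 13 ≤ n → (f : Perm n → Perm n) →
    InAutΓₑ n f ⇔ InAutGS n f
lemma2p6 n 13≤n f = at (ℕP.m≤n⇒∃[o]m+o≡n 13≤n)
  where
  at : ∃ (λ k → 13 + k ≡ n) → InAutΓₑ n f ⇔ InAutGS n f
  at (k , refl) = normal-13+ k f
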